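{- Let $n\ge2$ and $w\in\mathcal S_n$. Then $\Gamma(a_{\min},\tau)=0$ and $\Gamma(a_{\max},\tau)=1$ for every triple $\tau\in\mathrm{T}_w$.
   Context: Applying a letter $i\in\{1,\dots,n-1\}$ to a word of length $n$ swaps its entries in positions $i$ and $i+1$. The length $\ell(w)$ is the number of inversions of $w$ (pairs of values $p>q$ with $p$ before $q$ in $w$). A reduced word of $w$ is a word $a=a_1\cdots a_{\ell(w)}$ over $\{1,\dots,n-1\}$ such that applying successively $a_1,\dots,a_{\ell(w)}$ to the identity word $12\cdots n$ yields $w$. In this process each letter $a_j$ swaps two adjacent values $q<p$, each inversion pair $(p,q)$ of $w$ being swapped by exactly one letter; the canonical labelling is $P_a(p,q)=j$ iff $a_j$ swaps $p$ and $q$. $\mathrm{T}_w$ is the set of triples $(x,y,z)$ with $x<y<z$ such that $z$ appears before $y$ and $y$ before $x$ in $w$; $\Gamma(a,(x,y,z))=1$ if $P_a(y,x)>P_a(z,y)$ and $0$ if $P_a(y,x)<P_a(z,y)$. The words $a_{\min},a_{\max}$: set $w^0=w$ and, while $w^j$ is not the identity, let $i_j$ be the smallest (for $a_{\min}$), resp. largest (for $a_{\max}$), descent of $w^j$ (an index $i$ with $w^j_i>w^j_{i+1}$), and let $w^{j+1}$ be $w^j$ with the entries in positions $i_j,i_j+1$ swapped; this reaches the identity after $\ell(w)$ steps, and the reduced word is $i_{\ell(w)-1}\cdots i_1i_0$ (the chosen descents in reverse order). -}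

module Defs where

open import Data.Nat using (ℕ; zero; suc; _<ᵇ_; _≡ᵇ_; _+_)
open import Data.Bool using (Bool; true; false; _∧_; _∨_; if_then_else_)
open import Data.List using (List; []; _∷_; map; reverse; length; sum)
open import Data.Maybe using (Maybe; just; nothing)
open import Data.Fin using (Fin; toℕ; _<_)
open import Data.Fin.Permutation using (Permutation′; _⟨$⟩ʳ_; _⟨$⟩ˡ_)
open import Data.List using (allFin)
open import Data.Product using (_×_)

-- Words are lists of natural numbers; positions and letters are 1-based.

word : ∀ {n} → Permutation′ n → List ℕ
word {n} w = map (λ i → suc (toℕ (w ⟨$⟩ʳ i))) (allFin n)

-- Apply letter i: swap entries in positions i and i+1 (1-based).
-- (Letters outside {1,…,length−1} leave the word unchanged; they never occur.)
swapAt : ℕ → List ℕ → List ℕ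
swapAt (suc zero) (x ∷ y ∷ r) = y ∷ x ∷ r
swapAt (suc (suc k)) (x ∷ r) = x ∷ swapAt (suc k) r
swapAt _ u = u

pairAt : ℕ → List ℕ → Maybe (ℕ × ℕ)
pairAt (suc zero) (x ∷ y ∷ r) = just (x Data.Product., y)
pairAt (suc (suc k)) (x ∷ r) = pairAt (suc k) r
pairAt _ u = nothing

inversions : List ℕ → ℕ
inversions [] = 0
inversions (x ∷ r) = length (Data.List.filter (λ y → Data.Nat._<?_ y x) r) + inversions r

ℓ : ∀ {n} → Permutation′ n → ℕ
ℓ w = inversions (word w)

identityWord : ℕ → List ℕ
identityWord n = map (λ i → suc (toℕ i)) (allFin n)

applyWord : List ℕ → List ℕ → List ℕ
applyWord [] u = u
applyWord (i ∷ a) u = applyWord a (swapAt i u)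

IsReducedWord : ∀ {n} → Permutation′ n → List ℕ → Set
IsReducedWord {n} w a = (applyWord a (identityWord n) ≡ word w) × (length a ≡ ℓ w)
  where open import Relation.Binary.PropositionalEquality using (_≡_)

-- Canonical labelling P_a(p,q): the (1-based) index j such that the letter a_j swaps
-- the values p and q when a is applied successively to the identity word of length n.
labelFrom : ℕ → ℕ → ℕ → List ℕ → List ℕ → Maybe ℕ
labelFrom p q j [] u = nothing
labelFrom p q j (i ∷ a) u with pairAt i u
... | just (s Data.Product., t) =
  if ((s ≡ᵇ p) ∧ (t ≡ᵇ q)) ∨ ((s ≡ᵇ q) ∧ (t ≡ᵇ p))
  then just j
  else labelFrom p q (suc j) a (swapAt i u)
... | nothing = labelFrom p q (suc j) a (swapAt i u)

P : ℕ → List ℕ → ℕ → ℕ → Maybe ℕ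
P n a p q = labelFrom p q 1 a (identityWord n)

-- Γ(a,(x,y,z)) = just 1 if P_a(y,x) > P_a(z,y), just 0 if P_a(y,x) < P_a(z,y),
-- nothing otherwise (labels undefined or equal; this never happens for reduced words).
Γ : ℕ → List ℕ → ℕ → ℕ → ℕ → Maybe ℕ
Γ n a x y z with P n a y x | P n a z y
... | just j | just k = if k <ᵇ j then just 1 else (if j <ᵇ k then just 0 else nothing)
... | _ | _ = nothing

descents : ℕ → List ℕ → List ℕ
descents i (x ∷ y ∷ r) = if y <ᵇ x then i ∷ descents (suc i) (y ∷ r) else descents (suc i) (y ∷ r)
descents i _ = []

firstDescent : List ℕ → Maybe ℕ
firstDescent u with descents 1 u
... | [] = nothing
... | d ∷ _ = just d

lastOf : List ℕ → Maybe ℕ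
lastOf [] = nothing
lastOf (d ∷ []) = just d
lastOf (d ∷ e ∷ ds) = lastOf (e ∷ ds)

lastDescent : List ℕ → Maybe ℕ
lastDescent u = lastOf (descents 1 u)

sortSeq : (List ℕ → Maybe ℕ) → ℕ → List ℕ → List ℕ
sortSeq choose zero u = []
sortSeq choose (suc f) u with choose u
... | nothing = []
... | just i = i ∷ sortSeq choose f (swapAt i u)

aMin : ∀ {n} → Permutation′ n → List ℕ
aMin w = reverse (sortSeq firstDescent (ℓ w) (word w))

aMax : ∀ {n} → Permutation′ n → List ℕ
aMax w = reverse (sortSeq lastDescent (ℓ w) (word w))

val : ∀ {n} → Fin n → ℕ
val v = suc (toℕ v)

-- τ = (x,y,z) ∈ T_w : x < y < z and z appears before y, y before x in w.
InT : ∀ {n} → Permutation′ n → Fin n → Fin n → Fin n → Set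
InT w x y z = (x < y) × (y < z) × ((w ⟨$⟩ˡ z) < (w ⟨$⟩ˡ y)) × ((w ⟨$⟩ˡ y) < (w ⟨$⟩ˡ x))

{-# OPTIONS --safe #-}
-- Reading a word backwards undoes it, so the reverse of a_min (resp. a_max) is the run of bubble
-- sort on w that always swaps the leftmost (resp. rightmost) descent, and the t-th swap of the sort
-- is the letter labelled ℓ(w) + 1 − t: pairs swapped earlier in the sort get larger labels.  Each
-- step swaps one inverted adjacent pair, so every inversion of w is swapped exactly once.  Let
-- z, y, x occur in this order in w with x < y < z.  While z precedes y, the leftmost descent is
-- not y x, because the entries up to it increase, yet z > y precedes y; so z y is swapped first
-- and P(y,x) < P(z,y).  While y precedes x, the rightmost descent is not z y, because the entries
-- from it on increase, yet x < y follows y; so y x is swapped first and P(y,x) > P(z,y).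
module Submission where

open import Defs
open import Data.Nat using (ℕ; zero; suc; _+_; _≤_; _<_; _<ᵇ_; s≤s; z≤n)
open import Data.Nat.Properties
open import Data.Bool using (true; false; if_then_else_)
import Data.Fin as Fin
open import Data.Fin using (Fin; toℕ)
open import Data.Fin.Properties using (toℕ-injective; toℕ<n)
open import Data.Fin.Permutation using (Permutation′; _⟨$⟩ʳ_; _⟨$⟩ˡ_; inverseʳ)
open import Data.List using (List; []; _∷_; _∷ʳ_; _++_; length; reverse; filter; tabulate; allFin)
open import Data.List.Properties
  using (unfold-reverse; length-reverse; length-map; length-tabulate; map-tabulate; tabulate-cong;
         filter-accept; filter-reject; filter-some)
open import Data.List.Membership.Propositional using (_∈_; lose)
open import Data.List.Membership.Propositional.Properties using (∈-tabulate⁺)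
open import Data.List.Relation.Unary.All as All using (All; []; _∷_)
open import Data.List.Relation.Unary.All.Properties using (All¬⇒¬Any; ¬Any⇒All¬; tabulate⁺)
open import Data.List.Relation.Unary.AllPairs as AllPairs using (AllPairs; []; _∷_)
open import Data.List.Relation.Unary.Any as Any using (Any; here; there)
open import Data.List.Relation.Unary.Unique.Propositional using (Unique)
open import Data.List.Relation.Unary.Unique.Propositional.Properties using (Unique[x∷xs]⇒x∉xs)
import Data.List.Relation.Unary.Unique.Propositional.Properties as Unique
open import Data.List.Relation.Binary.Permutation.Propositional using (_↭_; ↭-refl; ↭-prep; ↭-swap; ↭-trans; ↭⇒↭ₛ)
open import Data.List.Relation.Binary.Permutation.Propositional.Properties using (All-resp-↭; ∈-resp-↭; ↭-length; filter-↭)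
open import Data.Maybe using (Maybe; just; nothing; _<∣>_)
open import Data.Maybe.Properties using (just-injective; <∣>-identityʳ)
open import Data.Product using (_×_; _,_; ∃-syntax; ∃₂; -,_)
import Data.Product as Product
open import Data.Sum using (_⊎_; inj₁; inj₂)
open import Data.Empty using (⊥; ⊥-elim)
open import Function using (_∘_)
open import Function.Bundles using (Injection)
open import Function.Properties.Inverse using (↔⇒↣)
open import Relation.Nullary using (¬_; yes; no; does)
open import Relation.Nullary.Decidable using (Dec; _×-dec_; _⊎-dec_; dec-true; dec-false)
open import Relation.Nullary.Reflects using (ofʸ; ofⁿ)
open import Relation.Binary.PropositionalEquality
open import Data.List.Relation.Binary.Permutation.Setoid.Properties (setoid ℕ) using (Unique-resp-↭)
open import Algebra.Properties.CommutativeSemigroup +-commutativeSemigroup using (x∙yz≈y∙xz)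

swapAt-involutive : ∀ i u → swapAt i (swapAt i u) ≡ u
swapAt-involutive zero u = refl
swapAt-involutive (suc zero) [] = refl
swapAt-involutive (suc zero) (x ∷ []) = refl
swapAt-involutive (suc zero) (x ∷ y ∷ r) = refl
swapAt-involutive (suc (suc k)) [] = refl
swapAt-involutive (suc (suc k)) (x ∷ r) = cong (x ∷_) (swapAt-involutive (suc k) r)

swapAt-↭ : ∀ i u → u ↭ swapAt i u
swapAt-↭ zero u = ↭-refl
swapAt-↭ (suc zero) [] = ↭-refl
swapAt-↭ (suc zero) (x ∷ []) = ↭-refl
swapAt-↭ (suc zero) (x ∷ y ∷ r) = ↭-swap x y ↭-refl
swapAt-↭ (suc (suc k)) [] = ↭-refl
swapAt-↭ (suc (suc k)) (x ∷ r) = ↭-prep x (swapAt-↭ (suc k) r)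

pairAt-swapAt : ∀ i u {a b} → pairAt i u ≡ just (a , b) → pairAt i (swapAt i u) ≡ just (b , a)
pairAt-swapAt (suc zero) (x ∷ y ∷ r) refl = refl
pairAt-swapAt (suc (suc k)) (x ∷ r) e = pairAt-swapAt (suc k) r e

applyWord-++ : ∀ a b u → applyWord (a ++ b) u ≡ applyWord b (applyWord a u)
applyWord-++ [] b u = refl
applyWord-++ (i ∷ a) b u = applyWord-++ a b (swapAt i u)

applyWord-reverse : ∀ a u → applyWord (reverse a) (applyWord a u) ≡ u
applyWord-reverse [] u = refl
applyWord-reverse (i ∷ a) u = begin
  applyWord (reverse (i ∷ a)) (applyWord a (swapAt i u))
    ≡⟨ cong (λ b → applyWord b (applyWord a (swapAt i u))) (unfold-reverse i a) ⟩
  applyWord (reverse a ∷ʳ i) (applyWord a (swapAt i u))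
    ≡⟨ applyWord-++ (reverse a) (i ∷ []) _ ⟩
  swapAt i (applyWord (reverse a) (applyWord a (swapAt i u)))
    ≡⟨ cong (swapAt i) (applyWord-reverse a (swapAt i u)) ⟩
  swapAt i (swapAt i u)
    ≡⟨ swapAt-involutive i u ⟩
  u ∎
  where open ≡-Reasoning

applyWord-↭ : ∀ a u → u ↭ applyWord a u
applyWord-↭ [] u = ↭-refl
applyWord-↭ (i ∷ a) u = ↭-trans (swapAt-↭ i u) (applyWord-↭ a (swapAt i u))

Unique-resp-↭′ : ∀ {u v} → u ↭ v → Unique u → Unique v
Unique-resp-↭′ = Unique-resp-↭ ∘ ↭⇒↭ₛ

Unique-swapAt : ∀ i {u} → Unique u → Unique (swapAt i u)
Unique-swapAt i {u} = Unique-resp-↭′ (swapAt-↭ i u)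

data Before (p q : ℕ) : List ℕ → Set where
  at-head : ∀ {r} → q ∈ r → Before p q (p ∷ r)
  in-tail : ∀ {x r} → Before p q r → Before p q (x ∷ r)

Before-∈ˡ : ∀ {p q u} → Before p q u → p ∈ u
Before-∈ˡ (at-head _) = here refl
Before-∈ˡ (in-tail b) = there (Before-∈ˡ b)

Before-∈ʳ : ∀ {p q u} → Before p q u → q ∈ u
Before-∈ʳ (at-head m) = there m
Before-∈ʳ (in-tail b) = there (Before-∈ʳ b)

Before-asym : ∀ {p q u} → Unique u → Before p q u → Before q p u → ⊥
Before-asym U (at-head m) (at-head _) = Unique[x∷xs]⇒x∉xs U m
Before-asym U (at-head _) (in-tail b) = Unique[x∷xs]⇒x∉xs U (Before-∈ʳ b)
Before-asym U (in-tail b) (at-head _) = Unique[x∷xs]⇒x∉xs U (Before-∈ʳ b)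
Before-asym (_ ∷ U) (in-tail b) (in-tail b′) = Before-asym U b b′

Before-AllPairs : ∀ {R : ℕ → ℕ → Set} {p q u} → AllPairs R u → Before p q u → R p q
Before-AllPairs (Rp ∷ _) (at-head m) = All.lookup Rp m
Before-AllPairs (_ ∷ R) (in-tail b) = Before-AllPairs R b

pairAt⇒Before : ∀ i u {a b} → pairAt i u ≡ just (a , b) → Before a b u
pairAt⇒Before (suc zero) (x ∷ y ∷ r) refl = at-head (here refl)
pairAt⇒Before (suc (suc k)) (x ∷ r) e = in-tail (pairAt⇒Before (suc k) r e)

Before-swapAt : ∀ {p q} i u {a b} → pairAt i u ≡ just (a , b) → ¬ (a ≡ p × b ≡ q) →
  Before p q u → Before p q (swapAt i u)
Before-swapAt (suc zero) (x ∷ y ∷ r) refl ab≢pq (at-head (here refl)) = ⊥-elim (ab≢pq (refl , refl))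
Before-swapAt (suc zero) (x ∷ y ∷ r) refl ab≢pq (at-head (there m)) = in-tail (at-head m)
Before-swapAt (suc zero) (x ∷ y ∷ r) refl ab≢pq (in-tail (at-head m)) = at-head (there m)
Before-swapAt (suc zero) (x ∷ y ∷ r) refl ab≢pq (in-tail (in-tail b)) = in-tail (in-tail b)
Before-swapAt (suc (suc k)) (x ∷ r) e ab≢pq (at-head m) = at-head (∈-resp-↭ (swapAt-↭ (suc k) r) m)
Before-swapAt (suc (suc k)) (x ∷ r) e ab≢pq (in-tail b) = in-tail (Before-swapAt (suc k) r e ab≢pq b)

DescentAt : List ℕ → ℕ → Set
DescentAt u i = ∃₂ λ a b → pairAt i u ≡ just (a , b) × b < a

descents-sound : ∀ k u {i} → i ∈ descents k u → ∃[ j ] (i ≡ k + j × DescentAt u (suc j))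
descents-sound k (a ∷ v@(b ∷ r)) m with ih ← descents-sound (suc k) v | b <ᵇ a | <ᵇ-reflects-< b a
... | true | ofʸ b<a with m
...   | here refl = 0 , sym (+-identityʳ k) , a , b , refl , b<a
...   | there m′ with ih m′
...     | j , refl , d = suc j , sym (+-suc k j) , d
descents-sound k (a ∷ b ∷ r) m | false | _ with ih m
... | j , refl , d = suc j , sym (+-suc k j) , d

descents-≥ : ∀ k u {i} → i ∈ descents k u → k ≤ i
descents-≥ k u m with descents-sound k u m
... | j , refl , _ = m≤m+n k j

descents-increasing : ∀ k u → AllPairs _<_ (descents k u)
descents-increasing k [] = []
descents-increasing k (a ∷ []) = []
descents-increasing k (a ∷ v@(b ∷ r)) with ih ← descents-increasing (suc k) v | b <ᵇ a
... | true = All.tabulate (descents-≥ (suc k) v) ∷ ih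
... | false = ih

Any-descents-∷ : ∀ {P : ℕ → Set} k a b r → Any P (descents (suc k) (b ∷ r)) → Any P (descents k (a ∷ b ∷ r))
Any-descents-∷ k a b r any with b <ᵇ a
... | true = there any
... | false = any

descents≡[]⇒AllPairs≤ : ∀ k u → descents k u ≡ [] → AllPairs _≤_ u
descents≡[]⇒AllPairs≤ k [] _ = []
descents≡[]⇒AllPairs≤ k (a ∷ []) _ = [] ∷ []
descents≡[]⇒AllPairs≤ k (a ∷ v@(b ∷ r)) e
  with ih ← descents≡[]⇒AllPairs≤ (suc k) v | b <ᵇ a | <ᵇ-reflects-< b a
... | true | _ with () ← e
... | false | ofⁿ b≮a with b≤r ∷ sorted ← ih e =
  (a≤b ∷ All.map (≤-trans a≤b) b≤r) ∷ b≤r ∷ sorted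
  where a≤b = ≮⇒≥ b≮a

inversion⇒descent : ∀ k u {p q} → Before p q u → q < p → ∃[ d ] d ∈ descents k u
inversion⇒descent k u B q<p with descents k u in eq
... | [] = ⊥-elim (<⇒≱ q<p (Before-AllPairs (descents≡[]⇒AllPairs≤ k u eq) B))
... | d ∷ _ = d , here refl

Any-<-shift : ∀ k j {ds} → Any (_< suc k + j) ds → Any (_< k + suc j) ds
Any-<-shift k j = Any.map (λ {d} lt → subst (d <_) (sym (+-suc k j)) lt)

Any->-shift : ∀ k j {ds} → Any (suc k + j <_) ds → Any (k + suc j <_) ds
Any->-shift k j = Any.map (λ {d} lt → subst (_< d) (sym (+-suc k j)) lt)

descent-left-of-head : ∀ k b v j {x y} → pairAt (suc j) (b ∷ v) ≡ just (y , x) → y < b →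
  Any (_< k + j) (descents k (b ∷ v))
descent-left-of-head k b [] (suc zero) ()
descent-left-of-head k b [] (suc (suc j)) ()
descent-left-of-head k b (b′ ∷ r) zero refl y<b = ⊥-elim (<-irrefl refl y<b)
descent-left-of-head k b (b′ ∷ r) (suc j) pe y<b
  with ih ← descent-left-of-head (suc k) b′ r j pe | b′ <ᵇ b | <ᵇ-reflects-< b′ b
... | true | _ = here (m<m+n k (s≤s z≤n))
... | false | ofⁿ b′≮b = Any-<-shift k j (ih (<-≤-trans y<b (≮⇒≥ b′≮b)))

descent-left-of : ∀ k u j {x y z} → Unique u → pairAt (suc j) u ≡ just (y , x) → Before z y u → y < z →
  Any (_< k + j) (descents k u)
descent-left-of k (a ∷ b ∷ r) zero U refl (at-head _) y<z = ⊥-elim (<-irrefl refl y<z)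
descent-left-of k (a ∷ b ∷ r) zero U refl (in-tail B) y<z = ⊥-elim (Unique[x∷xs]⇒x∉xs U (Before-∈ʳ B))
descent-left-of k (a ∷ v) (suc j) U pe (at-head _) y<z = descent-left-of-head k a v (suc j) pe y<z
descent-left-of k (a ∷ v@(b ∷ r)) (suc j) (_ ∷ U) pe (in-tail B) y<z =
  Any-descents-∷ k a b r (Any-<-shift k j (descent-left-of (suc k) v j U pe B y<z))

descent-right-of : ∀ k u j {x y z} → Unique u → pairAt (suc j) u ≡ just (z , y) → Before y x u → x < y →
  Any (k + j <_) (descents k u)
descent-right-of k (a ∷ b ∷ r) zero U refl (at-head _) x<y = ⊥-elim (Unique[x∷xs]⇒x∉xs U (here refl))
descent-right-of k (a ∷ b ∷ r) zero U refl (in-tail B@(at-head _)) x<y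
  with d , d∈ ← inversion⇒descent (suc k) (b ∷ r) B x<y =
  Any-descents-∷ k a b r (lose d∈ (subst (_≤ d) (cong suc (sym (+-identityʳ k))) (descents-≥ (suc k) (b ∷ r) d∈)))
descent-right-of k (a ∷ b ∷ r) zero (_ ∷ U) refl (in-tail (in-tail B)) x<y =
  ⊥-elim (Unique[x∷xs]⇒x∉xs U (Before-∈ˡ B))
descent-right-of k (a ∷ v) (suc j) U pe (at-head _) x<y =
  ⊥-elim (Unique[x∷xs]⇒x∉xs U (Before-∈ʳ (pairAt⇒Before (suc j) v pe)))
descent-right-of k (a ∷ v@(b ∷ r)) (suc j) (_ ∷ U) pe (in-tail B) x<y =
  Any-descents-∷ k a b r (Any->-shift k j (descent-right-of (suc k) v j U pe B x<y))

countSmaller : ℕ → List ℕ → ℕ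
countSmaller x v = length (filter (_<? x) v)

inversions-swapAt-descent : ∀ i u {a b} → pairAt i u ≡ just (a , b) → b < a →
  inversions u ≡ suc (inversions (swapAt i u))
inversions-swapAt-descent (suc zero) (a ∷ b ∷ r) refl b<a
  rewrite filter-accept (_<? a) {b} {r} b<a | filter-reject (_<? b) {a} {r} (<⇒≯ b<a) =
  cong suc (x∙yz≈y∙xz (countSmaller a r) (countSmaller b r) (inversions r))
inversions-swapAt-descent (suc (suc k)) (x ∷ r) pe b<a = begin
  countSmaller x r + inversions r
    ≡⟨ cong (countSmaller x r +_) (inversions-swapAt-descent (suc k) r pe b<a) ⟩
  countSmaller x r + suc (inversions r′)
    ≡⟨ +-suc (countSmaller x r) (inversions r′) ⟩
  suc (countSmaller x r + inversions r′)
    ≡⟨ cong (λ m → suc (m + inversions r′)) (↭-length (filter-↭ (_<? x) (swapAt-↭ (suc k) r))) ⟩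
  suc (countSmaller x r′ + inversions r′) ∎
  where
  open ≡-Reasoning
  r′ = swapAt (suc k) r

inversions≡0⇒AllPairs≤ : ∀ u → inversions u ≡ 0 → AllPairs _≤_ u
inversions≡0⇒AllPairs≤ [] _ = []
inversions≡0⇒AllPairs≤ (a ∷ r) e =
  All.map ≮⇒≥ (¬Any⇒All¬ r (λ any → <⇒≢ (filter-some (_<? a) any) (sym (m+n≡0⇒m≡0 (countSmaller a r) e))))
  ∷ inversions≡0⇒AllPairs≤ r (m+n≡0⇒n≡0 (countSmaller a r) e)

Swaps : ℕ → ℕ → ℕ × ℕ → Set
Swaps p q (s , t) = (s ≡ p × t ≡ q) ⊎ (s ≡ q × t ≡ p)

-- `does (swaps? p q st)` computes to the boolean test in `labelFrom`.
swaps? : ∀ p q st → Dec (Swaps p q st)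
swaps? p q (s , t) = ((s ≟ p) ×-dec (t ≟ q)) ⊎-dec ((s ≟ q) ×-dec (t ≟ p))

Swaps-sym : ∀ {p q a b} → Swaps p q (b , a) → Swaps p q (a , b)
Swaps-sym (inj₁ (b≡p , a≡q)) = inj₂ (a≡q , b≡p)
Swaps-sym (inj₂ (b≡q , a≡p)) = inj₁ (a≡p , b≡q)

Swaps-descent : ∀ {p q a b} → b < a → q < p → Swaps p q (a , b) → a ≡ p × b ≡ q
Swaps-descent b<a q<p (inj₁ ab≡pq) = ab≡pq
Swaps-descent b<a q<p (inj₂ (refl , refl)) = ⊥-elim (<-asym b<a q<p)

labelIfSwaps : ℕ → ℕ → ℕ × ℕ → ℕ → Maybe ℕ
labelIfSwaps p q st n = if does (swaps? p q st) then just n else nothing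

labelFrom-∷ʳ : ∀ p q j a {i u st} → pairAt i (applyWord a u) ≡ just st →
  labelFrom p q j (a ++ i ∷ []) u ≡ labelFrom p q j a u <∣> labelIfSwaps p q st (j + length a)
labelFrom-∷ʳ p q j [] {i} {u} pe with pairAt i u
labelFrom-∷ʳ p q j [] refl | just (s , t) rewrite +-identityʳ j = refl
labelFrom-∷ʳ p q j (i′ ∷ a) {u = u} {st} pe with pairAt i′ u
... | nothing = trans (labelFrom-∷ʳ p q (suc j) a pe)
      (cong (λ n → labelFrom p q (suc j) a (swapAt i′ u) <∣> labelIfSwaps p q st n) (sym (+-suc j (length a))))
... | just (s , t) with does (swaps? p q (s , t))
...   | true = refl
...   | false = trans (labelFrom-∷ʳ p q (suc j) a pe)
      (cong (λ n → labelFrom p q (suc j) a (swapAt i′ u) <∣> labelIfSwaps p q st n) (sym (+-suc j (length a))))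

labelFrom-bound : ∀ p q j a u {k} → labelFrom p q j a u ≡ just k → k < j + length a
labelFrom-bound p q j (i ∷ a) u {k} e with pairAt i u
... | nothing = subst (k <_) (sym (+-suc j (length a))) (labelFrom-bound p q (suc j) a _ e)
... | just (s , t) with does (swaps? p q (s , t))
...   | true = subst (_< j + suc (length a)) (just-injective e) (m<m+n j (s≤s z≤n))
...   | false = subst (k <_) (sym (+-suc j (length a))) (labelFrom-bound p q (suc j) a _ e)

consecutive : ℕ → ℕ → List ℕ
consecutive a zero = []
consecutive a (suc m) = a ∷ consecutive (suc a) m

length+<bound : ∀ {d D} v → AllPairs _<_ v → All (d <_) v → All (_< D) v → d < D → length v + d < D
length+<bound [] _ _ _ d<D = d<D
length+<bound {d} {D} (x ∷ v) (x<v ∷ inc) (d<x ∷ _) (x<D ∷ v<D) _ = begin-strict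
  suc (length v + d)  ≡⟨ sym (+-suc (length v) d) ⟩
  length v + suc d    ≤⟨ +-monoʳ-≤ (length v) d<x ⟩
  length v + x        <⟨ length+<bound v inc x<v v<D x<D ⟩
  D                   ∎
  where open ≤-Reasoning

increasing⇒consecutive : ∀ a m e → AllPairs _<_ e → All (a ≤_) e → All (_< a + m) e → length e ≡ m →
  e ≡ consecutive a m
increasing⇒consecutive a zero [] _ _ _ _ = refl
increasing⇒consecutive a (suc m) (x ∷ e) (x<e ∷ inc) (a≤x ∷ _) (x<a+m ∷ e<a+m) len =
  cong₂ _∷_ x≡a (increasing⇒consecutive (suc a) m e inc (subst (λ c → All (c <_) e) x≡a x<e)
                   (subst (λ c → All (_< c) e) (+-suc a m) e<a+m) (suc-injective len))
  where
  open ≤-Reasoning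
  x≤a : x ≤ a
  x≤a = +-cancelˡ-≤ m x a (m<1+n⇒m≤n (begin-strict
    m + x         ≡⟨ cong (_+ x) (sym (suc-injective len)) ⟩
    length e + x  <⟨ length+<bound e inc x<e e<a+m x<a+m ⟩
    a + suc m     ≡⟨ +-suc a m ⟩
    suc (a + m)   ≡⟨ cong suc (+-comm a m) ⟩
    suc (m + a)   ∎))
  x≡a : x ≡ a
  x≡a = ≤-antisym x≤a a≤x

tabulate-consecutive : ∀ a m → tabulate {n = m} (λ i → a + toℕ i) ≡ consecutive a m
tabulate-consecutive a zero = refl
tabulate-consecutive a (suc m) =
  cong₂ _∷_ (+-identityʳ a) (trans (tabulate-cong (λ i → +-suc a (toℕ i))) (tabulate-consecutive (suc a) m))

identityWord≡consecutive : ∀ n → identityWord n ≡ consecutive 1 n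
identityWord≡consecutive n = trans (map-tabulate (λ i → i) (λ i → suc (toℕ i))) (tabulate-consecutive 1 n)

word≡tabulate : ∀ {n} (w : Permutation′ n) → word w ≡ tabulate (λ i → val (w ⟨$⟩ʳ i))
word≡tabulate w = map-tabulate (λ i → i) (λ i → val (w ⟨$⟩ʳ i))

word-unique : ∀ {n} (w : Permutation′ n) → Unique (word w)
word-unique {n} w = Unique.map⁺ (Injection.injective (↔⇒↣ w) ∘ toℕ-injective ∘ suc-injective) (Unique.allFin⁺ n)

word-length : ∀ {n} (w : Permutation′ n) → length (word w) ≡ n
word-length {n} w = trans (length-map _ (allFin n)) (length-tabulate (λ i → i))

word-positive : ∀ {n} (w : Permutation′ n) → All (1 ≤_) (word w)
word-positive w = subst (All (1 ≤_)) (sym (word≡tabulate w)) (tabulate⁺ (λ _ → s≤s z≤n))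

word-bounded : ∀ {n} (w : Permutation′ n) → All (_< 1 + n) (word w)
word-bounded w = subst (All (_< _)) (sym (word≡tabulate w)) (tabulate⁺ (λ i → s≤s (toℕ<n (w ⟨$⟩ʳ i))))

Before-tabulate : ∀ {m} (g : Fin m → ℕ) {i j : Fin m} → toℕ i < toℕ j → Before (g i) (g j) (tabulate g)
Before-tabulate g {Fin.zero} {Fin.suc j} _ = at-head (∈-tabulate⁺ j)
Before-tabulate g {Fin.suc i} {Fin.suc j} (s≤s i<j) = in-tail (Before-tabulate (g ∘ Fin.suc) i<j)

Before-word : ∀ {n} (w : Permutation′ n) a b → toℕ (w ⟨$⟩ˡ a) < toℕ (w ⟨$⟩ˡ b) →
  Before (val a) (val b) (word w)
Before-word w a b lt = subst (Before (val a) (val b)) (sym (word≡tabulate w))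
  (subst₂ (λ s t → Before s t (tabulate (λ i → val (w ⟨$⟩ʳ i)))) (cong val (inverseʳ w)) (cong val (inverseʳ w))
    (Before-tabulate (λ i → val (w ⟨$⟩ʳ i)) lt))

module Sorting (choose : List ℕ → Maybe ℕ)
               (choose-descent : ∀ {u i} → choose u ≡ just i → i ∈ descents 1 u)
               (choose-sorted : ∀ {u} → choose u ≡ nothing → descents 1 u ≡ []) where

  sortEnd : ℕ → List ℕ → List ℕ
  sortEnd f u = applyWord (sortSeq choose f u) u

  label : ℕ → ℕ → ℕ → List ℕ → Maybe ℕ
  label p q f u = labelFrom p q 1 (reverse (sortSeq choose f u)) (sortEnd f u)

  -- Splitting on `choice u` rather than on `choose u` keeps `label` folded in the goal.
  choice : ∀ u → choose u ≡ nothing ⊎ ∃[ i ] choose u ≡ just i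
  choice u with choose u
  ... | nothing = inj₁ refl
  ... | just i = inj₂ (i , refl)

  label-stop : ∀ {p q f u} → choose u ≡ nothing → label p q (suc f) u ≡ nothing
  label-stop ci rewrite ci = refl

  label-step : ∀ p q f u {i a b} → choose u ≡ just i → pairAt i u ≡ just (a , b) →
    label p q (suc f) u ≡ label p q f (swapAt i u) <∣> labelIfSwaps p q (b , a) (suc (length (sortSeq choose f (swapAt i u))))
  label-step p q f u {i} {a} {b} ci pe rewrite ci = begin
    labelFrom p q 1 (reverse (i ∷ s)) (sortEnd f u′)
      ≡⟨ cong (λ c → labelFrom p q 1 c (sortEnd f u′)) (unfold-reverse i s) ⟩
    labelFrom p q 1 (reverse s ++ i ∷ []) (sortEnd f u′)
      ≡⟨ labelFrom-∷ʳ p q 1 (reverse s) (trans (cong (pairAt i) (applyWord-reverse s u′)) (pairAt-swapAt i u pe)) ⟩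
    label p q f u′ <∣> labelIfSwaps p q (b , a) (suc (length (reverse s)))
      ≡⟨ cong (λ n → label p q f u′ <∣> labelIfSwaps p q (b , a) (suc n)) (length-reverse s) ⟩
    label p q f u′ <∣> labelIfSwaps p q (b , a) (suc (length s)) ∎
    where
    open ≡-Reasoning
    u′ = swapAt i u
    s = sortSeq choose f u′

  label-now : ∀ {p q f u i} → choose u ≡ just i → pairAt i u ≡ just (p , q) →
    label p q (suc f) u ≡ label p q f (swapAt i u) <∣> just (suc (length (sortSeq choose f (swapAt i u))))
  label-now {p} {q} {f} {u} ci pe
    rewrite label-step p q f u ci pe | dec-true (swaps? p q (q , p)) (inj₂ (refl , refl)) = refl

  label-later : ∀ {p q f u i a b} → choose u ≡ just i → pairAt i u ≡ just (a , b) → ¬ Swaps p q (a , b) →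
    label p q (suc f) u ≡ label p q f (swapAt i u)
  label-later {p} {q} {f} {u} {a = a} {b} ci pe ¬swaps
    rewrite label-step p q f u ci pe | dec-false (swaps? p q (b , a)) (¬swaps ∘ Swaps-sym) = <∣>-identityʳ _

  label-bound : ∀ {p q f u k} → label p q f u ≡ just k → k ≤ length (sortSeq choose f u)
  label-bound {p} {q} {f} {u} e
    with s≤s k≤ ← labelFrom-bound p q 1 (reverse (sortSeq choose f u)) (sortEnd f u) e =
    subst (_ ≤_) (length-reverse (sortSeq choose f u)) k≤

  chosen-descent : ∀ {u i} → choose u ≡ just i → DescentAt u i
  chosen-descent {u} ci with _ , refl , d ← descents-sound 1 u (choose-descent ci) = d

  data SortingStep (f : ℕ) (u : List ℕ) : Set where
    step : ∀ {i a b f′} → choose u ≡ just i → pairAt i u ≡ just (a , b) → b < a →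
           f ≡ suc f′ → f′ ≡ inversions (swapAt i u) → SortingStep f u

  sortingStep : ∀ {f u p q} → f ≡ inversions u → Before p q u → q < p → SortingStep f u
  sortingStep {f} {u} fe B q<p with choose u in ci
  ... | nothing = ⊥-elim (<⇒≱ q<p (Before-AllPairs (descents≡[]⇒AllPairs≤ 1 u (choose-sorted ci)) B))
  ... | just i with a , b , pe , b<a ← chosen-descent ci =
    step ci pe b<a (trans fe (inversions-swapAt-descent i u pe b<a)) refl

  label-undefined : ∀ f u {p q} → Unique u → Before q p u → q < p → label p q f u ≡ nothing
  label-undefined zero u U B q<p = refl
  label-undefined (suc f) u {p} {q} U B q<p with choice u
  ... | inj₁ ci = label-stop ci
  ... | inj₂ (i , ci) with a , b , pe , b<a ← chosen-descent ci =
    trans (label-later ci pe ¬swaps) (label-undefined f (swapAt i u) (Unique-swapAt i U) (Before-swapAt i u pe ab≢qp B) q<p)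
    where
    ab≢pq : ¬ (a ≡ p × b ≡ q)
    ab≢pq (refl , refl) = Before-asym U (pairAt⇒Before i u pe) B
    ab≢qp : ¬ (a ≡ q × b ≡ p)
    ab≢qp (refl , refl) = <-asym b<a q<p
    ¬swaps : ¬ Swaps p q (a , b)
    ¬swaps = ab≢pq ∘ Swaps-descent b<a q<p

  label-defined : ∀ f u {p q} → f ≡ inversions u → Unique u → Before p q u → q < p →
    ∃[ k ] label p q f u ≡ just k
  label-defined f u {p} {q} fe U B q<p with sortingStep fe B q<p
  ... | step {i} {a} {b} {f′} ci pe b<a refl fe′ with (a ≟ p) ×-dec (b ≟ q)
  ...   | yes (refl , refl) rewrite label-now {f = f′} ci pe with label p q f′ (swapAt i u)
  ...     | just k = k , refl
  ...     | nothing = -, refl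
  label-defined f u {p} {q} fe U B q<p | step {i} {a} {b} {f′} ci pe b<a refl fe′ | no ab≢pq =
    Product.map₂ (trans (label-later ci pe (ab≢pq ∘ Swaps-descent b<a q<p)))
      (label-defined f′ (swapAt i u) fe′ (Unique-swapAt i U) (Before-swapAt i u pe ab≢pq B) q<p)

  label-order : ∀ {p q p′ q′} → q < p → q′ < p′ →
    (∀ {v i} → Unique v → Before p q v → choose v ≡ just i → pairAt i v ≡ just (p′ , q′) → ⊥) →
    ∀ f u → f ≡ inversions u → Unique u → Before p q u → Before p′ q′ u →
    ∃₂ λ j k → label p′ q′ f u ≡ just j × label p q f u ≡ just k × j < k
  label-order {p} {q} {p′} {q′} q<p q′<p′ avoids f u fe U B B′ with sortingStep fe B q<p
  ... | step {i} {a} {b} {f′} ci pe b<a refl fe′ with (a ≟ p′) ×-dec (b ≟ q′) | (a ≟ p) ×-dec (b ≟ q)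
  ...   | yes (refl , refl) | _ = ⊥-elim (avoids U B ci pe)
  ...   | no ab≢p′q′ | yes (refl , refl)
    with j , ℓj ← label-defined f′ (swapAt i u) fe′ (Unique-swapAt i U) (Before-swapAt i u pe ab≢p′q′ B′) q′<p′ =
    j , _ , trans (label-later ci pe (ab≢p′q′ ∘ Swaps-descent b<a q′<p′)) ℓj
          , trans (label-now ci pe) (cong (_<∣> just _) (label-undefined f′ (swapAt i u) (Unique-swapAt i U) qp-sorted q<p))
          , s≤s (label-bound {p′} {q′} {f′} {swapAt i u} ℓj)
    where qp-sorted = pairAt⇒Before i (swapAt i u) (pairAt-swapAt i u pe)
  label-order q<p q′<p′ avoids f u fe U B B′ | step {i} ci pe b<a refl fe′ | no ab≢p′q′ | no ab≢pq
    with j , k , ℓj , ℓk , j<k ← label-order q<p q′<p′ avoids _ (swapAt i u) fe′ (Unique-swapAt i U)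
                                   (Before-swapAt i u pe ab≢pq B) (Before-swapAt i u pe ab≢p′q′ B′) =
    j , k , trans (label-later ci pe (ab≢p′q′ ∘ Swaps-descent b<a q′<p′)) ℓj
          , trans (label-later ci pe (ab≢pq ∘ Swaps-descent b<a q<p)) ℓk , j<k

  sortEnd-sorted : ∀ f u → f ≡ inversions u → AllPairs _≤_ (sortEnd f u)
  sortEnd-sorted zero u fe = inversions≡0⇒AllPairs≤ u (sym fe)
  sortEnd-sorted (suc f) u fe with choose u in ci
  ... | nothing = descents≡[]⇒AllPairs≤ 1 u (choose-sorted ci)
  ... | just i with a , b , pe , b<a ← chosen-descent ci =
    sortEnd-sorted f (swapAt i u) (suc-injective (trans fe (inversions-swapAt-descent i u pe b<a)))

  sortEnd-word : ∀ {n} (w : Permutation′ n) → sortEnd (ℓ w) (word w) ≡ identityWord n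
  sortEnd-word {n} w = trans
    (increasing⇒consecutive 1 n _ increasing (All-resp-↭ sorting (word-positive w)) (All-resp-↭ sorting (word-bounded w))
       (trans (sym (↭-length sorting)) (word-length w)))
    (sym (identityWord≡consecutive n))
    where
    sorting = applyWord-↭ (sortSeq choose (ℓ w) (word w)) (word w)
    increasing = AllPairs.zipWith (Product.uncurry ≤∧≢⇒<)
      (sortEnd-sorted (ℓ w) (word w) refl , Unique-resp-↭′ sorting (word-unique w))

  reducedWord : ∀ {n} → Permutation′ n → List ℕ
  reducedWord w = reverse (sortSeq choose (ℓ w) (word w))

  reducedWord-order : ∀ {n} (w : Permutation′ n) {p q p′ q′} → q < p → q′ < p′ →
    (∀ {v i} → Unique v → Before p q v → choose v ≡ just i → pairAt i v ≡ just (p′ , q′) → ⊥) →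
    Before p q (word w) → Before p′ q′ (word w) →
    ∃₂ λ j k → P n (reducedWord w) p′ q′ ≡ just j × P n (reducedWord w) p q ≡ just k × j < k
  reducedWord-order {n} w {p} {q} {p′} {q′} q<p q′<p′ avoids B B′ =
    subst (λ v → ∃₂ λ j k → labelFrom p′ q′ 1 (reducedWord w) v ≡ just j
                        × labelFrom p q 1 (reducedWord w) v ≡ just k × j < k)
      (sortEnd-word w) (label-order q<p q′<p′ avoids (ℓ w) (word w) refl (word-unique w) B B′)

firstDescent-∈ : ∀ {u i} → firstDescent u ≡ just i → i ∈ descents 1 u
firstDescent-∈ {u} fd with descents 1 u
firstDescent-∈ refl | d ∷ _ = here refl

firstDescent-nothing : ∀ {u} → firstDescent u ≡ nothing → descents 1 u ≡ []
firstDescent-nothing {u} fd with descents 1 u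
... | [] = refl
firstDescent-nothing () | _ ∷ _

firstDescent-minimal : ∀ {u i} → firstDescent u ≡ just i → All (i ≤_) (descents 1 u)
firstDescent-minimal {u} fd with descents 1 u | descents-increasing 1 u
firstDescent-minimal refl | d ∷ _ | d<ds ∷ _ = ≤-refl ∷ All.map <⇒≤ d<ds

lastOf-∈ : ∀ {ds i} → lastOf ds ≡ just i → i ∈ ds
lastOf-∈ {d ∷ []} refl = here refl
lastOf-∈ {d ∷ e ∷ ds} l = there (lastOf-∈ l)

lastOf-nothing : ∀ {ds} → lastOf ds ≡ nothing → ds ≡ []
lastOf-nothing {[]} _ = refl
lastOf-nothing {d ∷ e ∷ ds} l with () ← lastOf-nothing {e ∷ ds} l

lastOf-maximal : ∀ {ds i} → AllPairs _<_ ds → lastOf ds ≡ just i → All (_≤ i) ds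
lastOf-maximal {d ∷ []} _ refl = ≤-refl ∷ []
lastOf-maximal {d ∷ e ∷ ds} ((d<e ∷ _) ∷ inc) l with e≤i ∷ ds≤i ← lastOf-maximal inc l =
  <⇒≤ (<-≤-trans d<e e≤i) ∷ e≤i ∷ ds≤i

firstDescent-avoids : ∀ {u i x y z} → Unique u → Before z y u → y < z →
  firstDescent u ≡ just i → pairAt i u ≡ just (y , x) → ⊥
firstDescent-avoids {u} U B y<z fd pe with descents-sound 1 u (firstDescent-∈ {u} fd)
... | j , refl , _ = All¬⇒¬Any (All.map ≤⇒≯ (firstDescent-minimal {u} fd)) (descent-left-of 1 u j U pe B y<z)

lastDescent-avoids : ∀ {u i x y z} → Unique u → Before y x u → x < y →
  lastDescent u ≡ just i → pairAt i u ≡ just (z , y) → ⊥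
lastDescent-avoids {u} U B x<y ld pe with descents-sound 1 u (lastOf-∈ {descents 1 u} ld)
... | j , refl , _ =
  All¬⇒¬Any (All.map ≤⇒≯ (lastOf-maximal (descents-increasing 1 u) ld)) (descent-right-of 1 u j U pe B x<y)

Γ≡0 : ∀ n a x y z → (∃₂ λ j k → P n a y x ≡ just j × P n a z y ≡ just k × j < k) → Γ n a x y z ≡ just 0
Γ≡0 n a x y z (j , k , ℓj , ℓk , j<k) rewrite ℓj | ℓk
  with k <ᵇ j | <ᵇ-reflects-< k j | j <ᵇ k | <ᵇ-reflects-< j k
... | true | ofʸ k<j | _ | _ = ⊥-elim (<-asym j<k k<j)
... | false | _ | true | _ = refl
... | false | _ | false | ofⁿ j≮k = ⊥-elim (j≮k j<k)

Γ≡1 : ∀ n a x y z → (∃₂ λ j k → P n a z y ≡ just j × P n a y x ≡ just k × j < k) → Γ n a x y z ≡ just 1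
Γ≡1 n a x y z (j , k , ℓj , ℓk , j<k) rewrite ℓj | ℓk with j <ᵇ k | <ᵇ-reflects-< j k
... | true | _ = refl
... | false | ofⁿ j≮k = ⊥-elim (j≮k j<k)

mainTheorem8 : (n : ℕ) → 2 ≤ n → (w : Permutation′ n) → (x y z : Fin n) → InT w x y z
    → (Γ n (aMin w) (val x) (val y) (val z) ≡ just 0) × (Γ n (aMax w) (val x) (val y) (val z) ≡ just 1)
mainTheorem8 n _ w x y z (x<y , y<z , z≺y , y≺x) =
  Γ≡0 n (aMin w) (val x) (val y) (val z)
    (Min.reducedWord-order w (s≤s y<z) (s≤s x<y) (λ U B → firstDescent-avoids U B (s≤s y<z)) zy yx) ,
  Γ≡1 n (aMax w) (val x) (val y) (val z)
    (Max.reducedWord-order w (s≤s x<y) (s≤s y<z) (λ U B → lastDescent-avoids U B (s≤s x<y)) yx zy)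
  where
  module Min = Sorting firstDescent (λ {u} → firstDescent-∈ {u}) (λ {u} → firstDescent-nothing {u})
  module Max = Sorting lastDescent (λ {u} → lastOf-∈ {descents 1 u}) (λ {u} → lastOf-nothing {descents 1 u})
  zy = Before-word w z y z≺y
  yx = Before-word w y x y≺x
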